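{- Let $a,b,n$ be integers with $1\le b\le n$. Then \[h_a(X_1,\ldots,X_n)=\sum_{l=0}^{b-1}h_{a-l}(X_{b-l},\ldots,X_n)\,h_l(X_1,\ldots,X_{b-l}).\]
   Context: Complete homogeneous symmetric functions extended to all integers: for $k\ge0$, $h_k(Z_1,\ldots,Z_m)=\sum_{l_1+\dots+l_m=k,\ l_r\ge0}Z_1^{l_1}\cdots Z_m^{l_m}$; for $k<0$, $h_k(Z_1,\ldots,Z_m)=(-1)^{m+1}\sum_{l_1+\dots+l_m=k,\ l_r<0}Z_1^{l_1}\cdots Z_m^{l_m}$. -}

module Defs where

open import Level using (Level)
open import Algebra.Bundles using (CommutativeRing)
open import Data.Nat as ℕ using (ℕ; zero; suc; _∸_; _≟_; _≤_)
open import Data.Nat.Properties using (≤-refl)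
open import Data.Integer as ℤ using (ℤ; +_; -[1+_])
open import Data.List as List using (List; []; _∷_; [_]; map; concatMap; upTo; filter; zipWith; length; foldr)
open import Data.List.Relation.Unary.All as All using (All)
open import Data.Product using (_×_; proj₁; proj₂)
open import Data.Nat.ListAction using (sum)
open import Relation.Nullary.Decidable using (_×-dec_)

boxes : ℕ → ℕ → List (List ℕ)
boxes zero    B = [ [] ]
boxes (suc m) B = concatMap (λ j → map (j ∷_) (boxes m B)) (upTo (suc B))

weakComps : ℕ → ℕ → List (List ℕ)
weakComps m k = filter (λ ls → sum ls ≟ k) (boxes m k)

-- Index set for k = -t < 0, written via the absolute values |l_r|:
-- (|l₁|,…,|l_m|) with |l_r| ≥ 1 and |l₁|+…+|l_m| = t.
posComps : ℕ → ℕ → List (List ℕ)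
posComps m t = filter (λ ls → (sum ls ≟ t) ×-dec All.all? (λ l → 1 ℕ.≤? l) ls) (boxes m t)

module _ {c ℓ : Level} (R : CommutativeRing c ℓ) where
  open CommutativeRing R

  pow : Carrier → ℕ → Carrier
  pow x zero    = 1#
  pow x (suc k) = x * pow x k

  sumR : List Carrier → Carrier
  sumR = foldr _+_ 0#

  prodR : List Carrier → Carrier
  prodR = foldr _*_ 1#

  -- A variable Z is given as the pair (Z , Z⁻¹); negative powers Z^l (l<0)
  -- are computed as (Z⁻¹)^{|l|}.
  -- Complete homogeneous symmetric function h_k(Z₁,…,Z_m), k ∈ ℤ.
  h : ℤ → List (Carrier × Carrier) → Carrier
  h (+ k)      zs = sumR (map (λ ls → prodR (zipWith (λ z l → pow (proj₁ z) l) zs ls))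
                              (weakComps (length zs) k))
  h -[1+ t ]   zs = pow (- 1#) (suc (length zs))
                    * sumR (map (λ ls → prodR (zipWith (λ z l → pow (proj₂ z) l) zs ls))
                                (posComps (length zs) (suc t)))

  -- The list of variables (X_i , X_i⁻¹) for i = i₀, i₀+1, …, j (empty if j < i₀).
  segment : (ℕ → Carrier) → (ℕ → Carrier) → ℕ → ℕ → List (Carrier × Carrier)
  segment X Y i j = map (λ r → (X (i ℕ.+ r) Data.Product., Y (i ℕ.+ r))) (upTo (suc j ∸ i))

-- Expanding the defining sums along the first variable gives, for every integer k and at
-- least two variables, h_k(X_i,…,X_n) = h_k(X_{i+1},…,X_n) + X_i h_{k-1}(X_i,…,X_n); for
-- k < 0 this uses X_i X_i⁻¹ = 1 and the alternating sign. Together with the recurrence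
-- h_{p+1}(X_1,…,X_{i+1}) = h_{p+1}(X_1,…,X_i) + X_{i+1} h_p(X_1,…,X_{i+1}) for the last
-- variable, each summand for b splits into a disjoint product
-- h_{a-l}(X_{b-l+1},…,X_n) h_l(X_1,…,X_{b-l}) plus a cross term, and each summand for b + 1
-- into the same cross term plus the next disjoint product. So the sum does not depend on
-- b, and for b = 1 it is h_a(X_1,…,X_n).
module Submission where

open import Level using (Level)
open import Algebra.Bundles using (CommutativeRing)
open import Data.Nat as ℕ using (ℕ; zero; suc; _∸_; _≤_; _<_; _≟_; z≤n; s≤s)
import Data.Nat.Properties as ℕₚ
open import Data.Integer as ℤ using (ℤ; +_; -[1+_])
import Data.Integer.Properties as ℤₚ
open import Data.List using (List; []; _∷_; _++_; [_]; _∷ʳ_; map; upTo; applyUpTo; concatMap; filter; length; zipWith)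
open import Data.List.Properties using (filter-++; filter-≐; filter-none; map-++; map-∘; map-cong; map-applyUpTo; upTo-∷ʳ)
open import Data.List.Relation.Unary.All as All using (All; _∷_)
open import Data.Nat.ListAction using (sum)
open import Data.Product using (_×_; _,_; proj₁; proj₂)
open import Data.Bool using (true; false)
open import Function using (_∘_; id)
open import Relation.Binary.PropositionalEquality as ≡ using (_≡_)
open import Relation.Nullary using (does)
open import Relation.Nullary.Decidable using (_×-dec_)
open import Relation.Unary using (Pred; Decidable)
open import Defs

filter-map : ∀ {a b p} {A : Set a} {B : Set b} {P : Pred B p} (P? : Decidable P) (f : A → B) xs →
             filter P? (map f xs) ≡ map f (filter (P? ∘ f) xs)
filter-map P? f []       = ≡.refl
filter-map P? f (x ∷ xs) with does (P? (f x))
... | true  = ≡.cong (f x ∷_) (filter-map P? f xs)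
... | false = filter-map P? f xs

[i-m]-1≡i-[1+m] : ∀ i m → (i ℤ.- + m) ℤ.- + 1 ≡ i ℤ.- + suc m
[i-m]-1≡i-[1+m] i m = begin
  i ℤ.+ ℤ.- + m ℤ.+ ℤ.- + 1   ≡⟨ ℤₚ.+-assoc i (ℤ.- + m) (ℤ.- + 1) ⟩
  i ℤ.+ (ℤ.- + m ℤ.+ ℤ.- + 1) ≡⟨ ≡.cong (λ j → i ℤ.+ j) (≡.sym (ℤₚ.neg-distrib-+ (+ m) (+ 1))) ⟩
  i ℤ.+ ℤ.- + (m ℕ.+ 1)       ≡⟨ ≡.cong (λ k → i ℤ.- + k) (ℕₚ.+-comm m 1) ⟩
  i ℤ.- + suc m               ∎
  where open ≡.≡-Reasoning

m+n≡o⇒m≤o : ∀ m {n o} → m ℕ.+ n ≡ o → m ≤ o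
m+n≡o⇒m≤o m {n} ≡.refl = ℕₚ.m≤m+n m n

m+n≡o⇒n≡o∸m : ∀ m {n o} → m ℕ.+ n ≡ o → n ≡ o ∸ m
m+n≡o⇒n≡o∸m m {n} ≡.refl = ≡.sym (ℕₚ.m+n∸m≡n m n)

n≡o∸m⇒m+n≡o : ∀ {m n o} → m ≤ o → n ≡ o ∸ m → m ℕ.+ n ≡ o
n≡o∸m⇒m+n≡o m≤o ≡.refl = ℕₚ.m+[n∸m]≡n m≤o

n<m⇒m∸n≡1+[m∸[1+n]] : ∀ {m n} → n < m → m ∸ n ≡ suc (m ∸ suc n)
n<m⇒m∸n≡1+[m∸[1+n]] {suc m} {zero}  _         = ≡.refl
n<m⇒m∸n≡1+[m∸[1+n]] {suc m} {suc n} (s≤s n<m) = n<m⇒m∸n≡1+[m∸[1+n]] n<m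

positiveComposition? : ∀ t → Decidable (λ ls → sum ls ≡ t × All (1 ≤_) ls)
positiveComposition? t ls = (sum ls ≟ t) ×-dec All.all? (λ l → 1 ℕ.≤? l) ls

module _ {r ℓ : Level} (R : CommutativeRing r ℓ) where
  open CommutativeRing R
  open import Relation.Binary.Reasoning.Setoid setoid
  open import Algebra.Properties.Ring ring using (-1*x≈-x)
  open import Algebra.Solver.Ring.NaturalCoefficients.Default commutativeSemiring
    using (solve; _:+_; _:*_; _:=_; con)

  Var : Set r
  Var = Carrier × Carrier

  ∑< : ℕ → (ℕ → Carrier) → Carrier
  ∑< zero    f = 0#
  ∑< (suc n) f = f 0 + ∑< n (f ∘ suc)

  syntax ∑< n (λ j → e) = ∑[ j < n ] e

  ∑-cong : ∀ n {f g : ℕ → Carrier} → (∀ j → j < n → f j ≈ g j) → ∑< n f ≈ ∑< n g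
  ∑-cong zero    f≈g = refl
  ∑-cong (suc n) f≈g = +-cong (f≈g 0 (s≤s z≤n)) (∑-cong n (λ j j<n → f≈g (suc j) (s≤s j<n)))

  ∑-zero : ∀ n {f : ℕ → Carrier} → (∀ j → j < n → f j ≈ 0#) → ∑< n f ≈ 0#
  ∑-zero n f≈0 = trans (∑-cong n f≈0) (∑0 n)
    where
    ∑0 : ∀ n → ∑[ j < n ] 0# ≈ 0#
    ∑0 zero    = refl
    ∑0 (suc n) = trans (+-identityˡ _) (∑0 n)

  ∑-truncate : ∀ {m n} (f : ℕ → Carrier) → m ≤ n → (∀ j → m ≤ j → j < n → f j ≈ 0#) → ∑< n f ≈ ∑< m f
  ∑-truncate {zero}  {n}     f _         vanish = ∑-zero n (λ j → vanish j z≤n)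
  ∑-truncate {suc m} {suc n} f (s≤s m≤n) vanish =
    +-congˡ (∑-truncate (f ∘ suc) m≤n (λ j m≤j j<n → vanish (suc j) (s≤s m≤j) (s≤s j<n)))

  ∑-+ : ∀ n (f g : ℕ → Carrier) → ∑[ j < n ] (f j + g j) ≈ ∑< n f + ∑< n g
  ∑-+ zero    f g = sym (+-identityˡ 0#)
  ∑-+ (suc n) f g = trans (+-congˡ (∑-+ n (f ∘ suc) (g ∘ suc)))
    (solve 4 (λ a b c d → (a :+ b) :+ (c :+ d) := (a :+ c) :+ (b :+ d)) refl _ _ _ _)

  ∑-distribˡ : ∀ n x (f : ℕ → Carrier) → ∑[ j < n ] (x * f j) ≈ x * ∑< n f
  ∑-distribˡ zero    x f = sym (zeroʳ x)
  ∑-distribˡ (suc n) x f = trans (+-congˡ (∑-distribˡ n x (f ∘ suc))) (sym (distribˡ x _ _))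

  ∑-last : ∀ n (f : ℕ → Carrier) → ∑< (suc n) f ≈ ∑< n f + f n
  ∑-last zero    f = trans (+-identityʳ _) (sym (+-identityˡ _))
  ∑-last (suc n) f = trans (+-congˡ (∑-last n (f ∘ suc))) (sym (+-assoc _ _ _))

  ∑-regroup : ∀ n {f g c u : ℕ → Carrier} →
              (∀ l → l < n → f l ≈ c l + u l) → g 0 ≈ c 0 →
              (∀ l → l < n → g (suc l) ≈ u l + c (suc l)) → c n ≈ 0# →
              ∑< n f ≈ ∑< (suc n) g
  ∑-regroup n {f} {g} {c} {u} f≈c+u g₀≈c₀ g≈u+c cₙ≈0 = begin
    ∑< n f                                   ≈⟨ trans (∑-cong n f≈c+u) (∑-+ n c u) ⟩
    ∑< n c + ∑< n u                          ≈⟨ +-congʳ (sym (trans (+-congˡ cₙ≈0) (+-identityʳ _))) ⟩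
    (∑< n c + c n) + ∑< n u                  ≈⟨ +-congʳ (sym (∑-last n c)) ⟩
    (c 0 + ∑< n (c ∘ suc)) + ∑< n u          ≈⟨ solve 3 (λ x y z → (x :+ y) :+ z := x :+ (z :+ y)) refl _ _ _ ⟩
    c 0 + (∑< n u + ∑< n (c ∘ suc))          ≈⟨ +-congˡ (sym (∑-+ n u (c ∘ suc))) ⟩
    c 0 + ∑[ l < n ] (u l + c (suc l))       ≈⟨ +-cong (sym g₀≈c₀) (sym (∑-cong n g≈u+c)) ⟩
    ∑< (suc n) g                             ∎

  sumR-map-applyUpTo : ∀ (f : ℕ → Carrier) g n → sumR R (map f (applyUpTo g n)) ≡ ∑< n (f ∘ g)
  sumR-map-applyUpTo f g zero    = ≡.refl
  sumR-map-applyUpTo f g (suc n) = ≡.cong (λ s → f (g 0) + s) (sumR-map-applyUpTo f (g ∘ suc) n)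

  sumR-map-++ : ∀ {A : Set} (f : A → Carrier) xs ys →
                sumR R (map f (xs ++ ys)) ≈ sumR R (map f xs) + sumR R (map f ys)
  sumR-map-++ f []       ys = sym (+-identityˡ _)
  sumR-map-++ f (x ∷ xs) ys = trans (+-congˡ (sumR-map-++ f xs ys)) (sym (+-assoc _ _ _))

  sumR-map-distribˡ : ∀ {A : Set} x (f : A → Carrier) xs →
                      sumR R (map (λ a → x * f a) xs) ≈ x * sumR R (map f xs)
  sumR-map-distribˡ x f []       = sym (zeroʳ x)
  sumR-map-distribˡ x f (a ∷ xs) = trans (+-congˡ (sumR-map-distribˡ x f xs)) (sym (distribˡ x _ _))

  sumR-filter-boxes-suc : ∀ {p} {P : Pred (List ℕ) p} (P? : Decidable P) (T : List ℕ → Carrier) m B →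
    sumR R (map T (filter P? (boxes (suc m) B)))
      ≈ ∑[ j < suc B ] sumR R (map (T ∘ (j ∷_)) (filter (P? ∘ (j ∷_)) (boxes m B)))
  sumR-filter-boxes-suc P? T m B =
    trans (over (upTo (suc B))) (reflexive (sumR-map-applyUpTo _ id (suc B)))
    where
    slice : ℕ → Carrier
    slice j = sumR R (map (T ∘ (j ∷_)) (filter (P? ∘ (j ∷_)) (boxes m B)))

    filter-slice : ∀ j → sumR R (map T (filter P? (map (j ∷_) (boxes m B)))) ≡ slice j
    filter-slice j = ≡.trans (≡.cong (sumR R ∘ map T) (filter-map P? (j ∷_) (boxes m B)))
                             (≡.cong (sumR R) (≡.sym (map-∘ (filter (P? ∘ (j ∷_)) (boxes m B)))))

    over : ∀ js → sumR R (map T (filter P? (concatMap (λ j → map (j ∷_) (boxes m B)) js)))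
                ≈ sumR R (map slice js)
    over []       = refl
    over (j ∷ js) = begin
      sumR R (map T (filter P? (map (j ∷_) (boxes m B) ++ rest)))
        ≡⟨ ≡.cong (sumR R ∘ map T) (filter-++ P? (map (j ∷_) (boxes m B)) rest) ⟩
      sumR R (map T (filter P? (map (j ∷_) (boxes m B)) ++ filter P? rest))
        ≈⟨ sumR-map-++ T (filter P? (map (j ∷_) (boxes m B))) (filter P? rest) ⟩
      sumR R (map T (filter P? (map (j ∷_) (boxes m B)))) + sumR R (map T (filter P? rest))
        ≈⟨ +-cong (reflexive (filter-slice j)) (over js) ⟩
      slice j + sumR R (map slice js) ∎
      where
      rest : List (List ℕ)
      rest = concatMap (λ j → map (j ∷_) (boxes m B)) js

  -- Expansion of h along the first variable

  monomial : (Var → Carrier) → List Var → List ℕ → Carrier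
  monomial pr zs ls = prodR R (zipWith (λ z l → pow R (pr z) l) zs ls)

  -- The defining sums of h run over boxes {0,…,B}^m; their value does not depend on the
  -- bound B as long as it is at least the degree, which makes expansion along the first
  -- variable an induction.
  hBox⁺ : List Var → ℕ → ℕ → Carrier
  hBox⁺ zs B k = sumR R (map (monomial proj₁ zs) (filter (λ ls → sum ls ≟ k) (boxes (length zs) B)))

  hBox⁻ : List Var → ℕ → ℕ → Carrier
  hBox⁻ zs B t = sumR R (map (monomial proj₂ zs) (filter (positiveComposition? t) (boxes (length zs) B)))

  hBox⁺-∷ : ∀ z zs {B k} → k ≤ B →
            hBox⁺ (z ∷ zs) B k ≈ ∑[ j < suc k ] (pow R (proj₁ z) j * hBox⁺ zs B (k ∸ j))
  hBox⁺-∷ z zs {B} {k} k≤B = begin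
    hBox⁺ (z ∷ zs) B k
      ≈⟨ sumR-filter-boxes-suc P? (monomial proj₁ (z ∷ zs)) (length zs) B ⟩
    ∑< (suc B) slice
      ≈⟨ ∑-truncate slice (s≤s k≤B) (λ j k<j _ → reflexive (outside k<j)) ⟩
    ∑< (suc k) slice
      ≈⟨ ∑-cong (suc k) (λ { j (s≤s j≤k) → inside j≤k }) ⟩
    ∑[ j < suc k ] (pow R (proj₁ z) j * hBox⁺ zs B (k ∸ j)) ∎
    where
    P? : Decidable (λ ls → sum ls ≡ k)
    P? ls = sum ls ≟ k

    term : ℕ → List ℕ → Carrier
    term j = monomial proj₁ (z ∷ zs) ∘ (j ∷_)

    slice : ℕ → Carrier
    slice j = sumR R (map (term j) (filter (P? ∘ (j ∷_)) (boxes (length zs) B)))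

    outside : ∀ {j} → k < j → slice j ≡ 0#
    outside {j} k<j = ≡.cong (sumR R ∘ map (term j)) (filter-none (P? ∘ (j ∷_))
      (All.universal (λ _ j+s≡k → ℕₚ.<⇒≱ k<j (m+n≡o⇒m≤o j j+s≡k))
                     (boxes (length zs) B)))

    inside : ∀ {j} → j ≤ k → slice j ≈ pow R (proj₁ z) j * hBox⁺ zs B (k ∸ j)
    inside {j} j≤k = begin
      slice j
        ≡⟨ ≡.cong (sumR R ∘ map (term j)) (filter-≐ (P? ∘ (j ∷_)) (λ ls → sum ls ≟ k ∸ j)
             (m+n≡o⇒n≡o∸m j , n≡o∸m⇒m+n≡o j≤k)
             (boxes (length zs) B)) ⟩
      sumR R (map (λ ls → pow R (proj₁ z) j * monomial proj₁ zs ls)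
                  (filter (λ ls → sum ls ≟ k ∸ j) (boxes (length zs) B)))
        ≈⟨ sumR-map-distribˡ (pow R (proj₁ z) j) (monomial proj₁ zs)
             (filter (λ ls → sum ls ≟ k ∸ j) (boxes (length zs) B)) ⟩
      pow R (proj₁ z) j * hBox⁺ zs B (k ∸ j) ∎

  hBox⁺-bound : ∀ zs {B B′ k} → k ≤ B → k ≤ B′ → hBox⁺ zs B k ≈ hBox⁺ zs B′ k
  hBox⁺-bound []       _   _    = refl
  hBox⁺-bound (z ∷ zs) {B} {B′} {k} k≤B k≤B′ = begin
    hBox⁺ (z ∷ zs) B k                                        ≈⟨ hBox⁺-∷ z zs k≤B ⟩
    ∑[ j < suc k ] (pow R (proj₁ z) j * hBox⁺ zs B (k ∸ j))   ≈⟨ ∑-cong (suc k) (λ j _ → *-congˡ {pow R (proj₁ z) j}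
      (hBox⁺-bound zs (ℕₚ.≤-trans (ℕₚ.m∸n≤m k j) k≤B) (ℕₚ.≤-trans (ℕₚ.m∸n≤m k j) k≤B′))) ⟩
    ∑[ j < suc k ] (pow R (proj₁ z) j * hBox⁺ zs B′ (k ∸ j))  ≈⟨ sym (hBox⁺-∷ z zs k≤B′) ⟩
    hBox⁺ (z ∷ zs) B′ k                                       ∎

  h⁺-∷ : ∀ k z zs → h R (+ k) (z ∷ zs) ≈ ∑[ j < suc k ] (pow R (proj₁ z) j * h R (+ (k ∸ j)) zs)
  h⁺-∷ k z zs = trans (hBox⁺-∷ z zs ℕₚ.≤-refl)
    (∑-cong (suc k) (λ j _ → *-congˡ {pow R (proj₁ z) j}
      (hBox⁺-bound zs {k} {k ∸ j} {k ∸ j} (ℕₚ.m∸n≤m k j) ℕₚ.≤-refl)))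

  -- Pascal-type recurrences

  h-zero : ∀ zs → h R (+ 0) zs ≈ 1#
  h-zero []       = +-identityʳ 1#
  h-zero (z ∷ zs) = begin
    h R (+ 0) (z ∷ zs)      ≈⟨ h⁺-∷ 0 z zs ⟩
    1# * h R (+ 0) zs + 0#  ≈⟨ +-identityʳ _ ⟩
    1# * h R (+ 0) zs       ≈⟨ *-identityˡ _ ⟩
    h R (+ 0) zs            ≈⟨ h-zero zs ⟩
    1#                      ∎

  h-[] : ∀ {k} → 1 ≤ k → h R (+ k) [] ≈ 0#
  h-[] (s≤s _) = refl

  h-suc-∷ : ∀ k z zs → h R (+ suc k) (z ∷ zs) ≈ h R (+ suc k) zs + proj₁ z * h R (+ k) (z ∷ zs)
  h-suc-∷ k z zs = begin
    h R (+ suc k) (z ∷ zs)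
      ≈⟨ h⁺-∷ (suc k) z zs ⟩
    1# * h R (+ suc k) zs + ∑[ j < suc k ] ((x * pow R x j) * h R (+ (k ∸ j)) zs)
      ≈⟨ +-cong (*-identityˡ _) (∑-cong (suc k) (λ j _ → *-assoc x (pow R x j) (h R (+ (k ∸ j)) zs))) ⟩
    h R (+ suc k) zs + ∑[ j < suc k ] (x * (pow R x j * h R (+ (k ∸ j)) zs))
      ≈⟨ +-congˡ (∑-distribˡ (suc k) x (λ j → pow R x j * h R (+ (k ∸ j)) zs)) ⟩
    h R (+ suc k) zs + x * ∑[ j < suc k ] (pow R x j * h R (+ (k ∸ j)) zs)
      ≈⟨ +-congˡ (*-congˡ (sym (h⁺-∷ k z zs))) ⟩
    h R (+ suc k) zs + x * h R (+ k) (z ∷ zs) ∎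
    where
    x : Carrier
    x = proj₁ z

  h-suc-∷ʳ : ∀ k zs w → h R (+ suc k) (zs ∷ʳ w) ≈ h R (+ suc k) zs + proj₁ w * h R (+ k) (zs ∷ʳ w)
  h-suc-∷ʳ k []       w = h-suc-∷ k w []
  h-suc-∷ʳ zero (z ∷ zs) w = begin
    h R (+ 1) (z ∷ zs ∷ʳ w)
      ≈⟨ h-suc-∷ 0 z (zs ∷ʳ w) ⟩
    h R (+ 1) (zs ∷ʳ w) + proj₁ z * h R (+ 0) (z ∷ zs ∷ʳ w)
      ≈⟨ +-cong (h-suc-∷ʳ 0 zs w) (*-congˡ (h-zero (z ∷ zs ∷ʳ w))) ⟩
    (h R (+ 1) zs + proj₁ w * h R (+ 0) (zs ∷ʳ w)) + proj₁ z * 1#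
      ≈⟨ +-congʳ (+-congˡ (*-congˡ (h-zero (zs ∷ʳ w)))) ⟩
    (h R (+ 1) zs + proj₁ w * 1#) + proj₁ z * 1#
      ≈⟨ solve 3 (λ s x y → (s :+ y) :+ x := (s :+ x) :+ y) refl _ _ _ ⟩
    (h R (+ 1) zs + proj₁ z * 1#) + proj₁ w * 1#
      ≈⟨ +-cong (+-congˡ (*-congˡ (sym (h-zero (z ∷ zs))))) (*-congˡ (sym (h-zero (z ∷ zs ∷ʳ w)))) ⟩
    (h R (+ 1) zs + proj₁ z * h R (+ 0) (z ∷ zs)) + proj₁ w * h R (+ 0) (z ∷ zs ∷ʳ w)
      ≈⟨ +-congʳ (sym (h-suc-∷ 0 z zs)) ⟩
    h R (+ 1) (z ∷ zs) + proj₁ w * h R (+ 0) (z ∷ zs ∷ʳ w) ∎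
  h-suc-∷ʳ (suc k) (z ∷ zs) w = begin
    h R (+ suc (suc k)) (z ∷ zs ∷ʳ w)
      ≈⟨ h-suc-∷ (suc k) z (zs ∷ʳ w) ⟩
    h R (+ suc (suc k)) (zs ∷ʳ w) + proj₁ z * h R (+ suc k) (z ∷ zs ∷ʳ w)
      ≈⟨ +-cong (h-suc-∷ʳ (suc k) zs w) (*-congˡ (h-suc-∷ʳ k (z ∷ zs) w)) ⟩
    (h R (+ suc (suc k)) zs + proj₁ w * h R (+ suc k) (zs ∷ʳ w))
      + proj₁ z * (h R (+ suc k) (z ∷ zs) + proj₁ w * h R (+ k) (z ∷ zs ∷ʳ w))
      ≈⟨ solve 6 (λ a b c d x y → (a :+ y :* b) :+ x :* (c :+ y :* d)
                                  := (a :+ x :* c) :+ y :* (b :+ x :* d)) refl _ _ _ _ _ _ ⟩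
    (h R (+ suc (suc k)) zs + proj₁ z * h R (+ suc k) (z ∷ zs))
      + proj₁ w * (h R (+ suc k) (zs ∷ʳ w) + proj₁ z * h R (+ k) (z ∷ zs ∷ʳ w))
      ≈⟨ sym (+-cong (h-suc-∷ (suc k) z zs) (*-congˡ (h-suc-∷ k z (zs ∷ʳ w)))) ⟩
    h R (+ suc (suc k)) (z ∷ zs) + proj₁ w * h R (+ suc k) (z ∷ zs ∷ʳ w) ∎

  hBox⁻-∷ : ∀ z zs {B t} → t ≤ B →
            hBox⁻ (z ∷ zs) B t ≈ ∑[ j < t ] (pow R (proj₂ z) (suc j) * hBox⁻ zs B (t ∸ suc j))
  hBox⁻-∷ z zs {B} {t} t≤B = begin
    hBox⁻ (z ∷ zs) B t
      ≈⟨ sumR-filter-boxes-suc P? (monomial proj₂ (z ∷ zs)) (length zs) B ⟩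
    slice 0 + ∑< B (slice ∘ suc)
      ≈⟨ trans (+-congʳ (reflexive zeroth)) (+-identityˡ _) ⟩
    ∑< B (slice ∘ suc)
      ≈⟨ ∑-truncate (slice ∘ suc) t≤B (λ j t≤j _ → reflexive (outside t≤j)) ⟩
    ∑< t (slice ∘ suc)
      ≈⟨ ∑-cong t (λ j j<t → inside j<t) ⟩
    ∑[ j < t ] (pow R (proj₂ z) (suc j) * hBox⁻ zs B (t ∸ suc j)) ∎
    where
    P? : Decidable (λ ls → sum ls ≡ t × All (1 ≤_) ls)
    P? = positiveComposition? t

    term : ℕ → List ℕ → Carrier
    term j = monomial proj₂ (z ∷ zs) ∘ (j ∷_)

    slice : ℕ → Carrier
    slice j = sumR R (map (term j) (filter (P? ∘ (j ∷_)) (boxes (length zs) B)))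

    zeroth : slice 0 ≡ 0#
    zeroth = ≡.cong (sumR R ∘ map (term 0)) (filter-none (P? ∘ (0 ∷_))
      (All.universal (λ { _ (_ , () ∷ _) }) (boxes (length zs) B)))

    outside : ∀ {j} → t ≤ j → slice (suc j) ≡ 0#
    outside {j} t≤j = ≡.cong (sumR R ∘ map (term (suc j))) (filter-none (P? ∘ (suc j ∷_))
      (All.universal (λ _ (j+s≡t , _) → ℕₚ.<⇒≱ (s≤s t≤j) (m+n≡o⇒m≤o (suc j) j+s≡t))
                     (boxes (length zs) B)))

    inside : ∀ {j} → j < t → slice (suc j) ≈ pow R (proj₂ z) (suc j) * hBox⁻ zs B (t ∸ suc j)
    inside {j} j<t = begin
      slice (suc j)
        ≡⟨ ≡.cong (sumR R ∘ map (term (suc j))) (filter-≐ (P? ∘ (suc j ∷_)) (positiveComposition? (t ∸ suc j))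
             ( (λ { (j+s≡t , _ ∷ pos) → m+n≡o⇒n≡o∸m (suc j) j+s≡t , pos })
             , (λ { (s≡t∸j , pos) → n≡o∸m⇒m+n≡o j<t s≡t∸j , s≤s z≤n ∷ pos }) )
             (boxes (length zs) B)) ⟩
      sumR R (map (λ ls → pow R (proj₂ z) (suc j) * monomial proj₂ zs ls)
                  (filter (positiveComposition? (t ∸ suc j)) (boxes (length zs) B)))
        ≈⟨ sumR-map-distribˡ (pow R (proj₂ z) (suc j)) (monomial proj₂ zs)
             (filter (positiveComposition? (t ∸ suc j)) (boxes (length zs) B)) ⟩
      pow R (proj₂ z) (suc j) * hBox⁻ zs B (t ∸ suc j) ∎

  hBox⁻-bound : ∀ zs {B B′ t} → t ≤ B → t ≤ B′ → hBox⁻ zs B t ≈ hBox⁻ zs B′ t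
  hBox⁻-bound []       _   _    = refl
  hBox⁻-bound (z ∷ zs) {B} {B′} {t} t≤B t≤B′ = begin
    hBox⁻ (z ∷ zs) B t                                             ≈⟨ hBox⁻-∷ z zs t≤B ⟩
    ∑[ j < t ] (pow R (proj₂ z) (suc j) * hBox⁻ zs B (t ∸ suc j))  ≈⟨ ∑-cong t (λ j _ →
      *-congˡ {pow R (proj₂ z) (suc j)} (hBox⁻-bound zs {B} {B′} {t ∸ suc j}
        (ℕₚ.≤-trans (ℕₚ.m∸n≤m t (suc j)) t≤B) (ℕₚ.≤-trans (ℕₚ.m∸n≤m t (suc j)) t≤B′))) ⟩
    ∑[ j < t ] (pow R (proj₂ z) (suc j) * hBox⁻ zs B′ (t ∸ suc j)) ≈⟨ sym (hBox⁻-∷ z zs t≤B′) ⟩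
    hBox⁻ (z ∷ zs) B′ t                                            ∎

  -- h R -[1+ t ] zs is, up to the sign (-1)^(length zs + 1), the value h⁻ zs (suc t).
  h⁻ : List Var → ℕ → Carrier
  h⁻ zs t = hBox⁻ zs t t

  h⁻-∷ : ∀ t z zs → h⁻ (z ∷ zs) t ≈ ∑[ j < t ] (pow R (proj₂ z) (suc j) * h⁻ zs (t ∸ suc j))
  h⁻-∷ t z zs = trans (hBox⁻-∷ z zs ℕₚ.≤-refl) (∑-cong t (λ j _ → *-congˡ {pow R (proj₂ z) (suc j)}
    (hBox⁻-bound zs {t} {t ∸ suc j} {t ∸ suc j} (ℕₚ.m∸n≤m t (suc j)) ℕₚ.≤-refl)))

  h⁻-one-∷-∷ : ∀ z w ws → h⁻ (z ∷ w ∷ ws) 1 ≈ 0#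
  h⁻-one-∷-∷ z w ws = begin
    h⁻ (z ∷ w ∷ ws) 1                        ≈⟨ h⁻-∷ 1 z (w ∷ ws) ⟩
    pow R (proj₂ z) 1 * h⁻ (w ∷ ws) 0 + 0#   ≈⟨ +-identityʳ _ ⟩
    pow R (proj₂ z) 1 * h⁻ (w ∷ ws) 0        ≈⟨ *-congˡ (h⁻-∷ 0 w ws) ⟩
    pow R (proj₂ z) 1 * 0#                   ≈⟨ zeroʳ _ ⟩
    0#                                       ∎

  h⁻-suc-suc-∷ : ∀ t z zs →
    h⁻ (z ∷ zs) (suc (suc t)) ≈ proj₂ z * h⁻ zs (suc t) + proj₂ z * h⁻ (z ∷ zs) (suc t)
  h⁻-suc-suc-∷ t z zs = begin
    h⁻ (z ∷ zs) (suc (suc t))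
      ≈⟨ h⁻-∷ (suc (suc t)) z zs ⟩
    (y * 1#) * h⁻ zs (suc t) + ∑[ j < suc t ] ((y * pow R y (suc j)) * h⁻ zs (t ∸ j))
      ≈⟨ +-cong (*-congʳ (*-identityʳ y))
                (∑-cong (suc t) (λ j _ → *-assoc y (pow R y (suc j)) (h⁻ zs (t ∸ j)))) ⟩
    y * h⁻ zs (suc t) + ∑[ j < suc t ] (y * (pow R y (suc j) * h⁻ zs (t ∸ j)))
      ≈⟨ +-congˡ (∑-distribˡ (suc t) y (λ j → pow R y (suc j) * h⁻ zs (t ∸ j))) ⟩
    y * h⁻ zs (suc t) + y * ∑[ j < suc t ] (pow R y (suc j) * h⁻ zs (t ∸ j))
      ≈⟨ +-congˡ (*-congˡ (sym (h⁻-∷ (suc t) z zs))) ⟩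
    y * h⁻ zs (suc t) + y * h⁻ (z ∷ zs) (suc t) ∎
    where
    y : Carrier
    y = proj₂ z

  alternating-cancel : ∀ {x y} s A B → x * y ≈ 1# →
    s * A + x * ((- 1# * s) * (y * A + y * B)) ≈ (- 1# * s) * B
  alternating-cancel {x} {y} s A B xy≈1 = begin
    s * A + x * (m * (y * A + y * B))          ≈⟨ +-congˡ (solve 5 (λ x m y A B →
      x :* (m :* (y :* A :+ y :* B)) := m :* ((x :* y) :* A :+ (x :* y) :* B)) refl x m y A B) ⟩
    s * A + m * ((x * y) * A + (x * y) * B)   ≈⟨ +-congˡ (*-congˡ (+-cong (*-congʳ xy≈1) (*-congʳ xy≈1))) ⟩
    s * A + m * (1# * A + 1# * B)             ≈⟨ solve 4 (λ s m A B →
      s :* A :+ m :* (con 1 :* A :+ con 1 :* B) := (s :+ m) :* A :+ m :* B) refl s m A B ⟩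
    (s + m) * A + m * B                       ≈⟨ +-congʳ (*-congʳ s+m≈0) ⟩
    0# * A + m * B                            ≈⟨ trans (+-congʳ (zeroˡ A)) (+-identityˡ _) ⟩
    m * B                                     ∎
    where
    m : Carrier
    m = - 1# * s
    s+m≈0 : s + m ≈ 0#
    s+m≈0 = trans (+-congˡ (-1*x≈-x s)) (-‿inverseʳ s)

  h-negsuc-∷ : ∀ t {x y} zs → x * y ≈ 1# →
    h R -[1+ t ] ((x , y) ∷ zs) ≈ h R -[1+ t ] zs + x * h R -[1+ suc t ] ((x , y) ∷ zs)
  h-negsuc-∷ t {x} {y} zs xy≈1 = sym (begin
    s * A + x * ((- 1# * s) * h⁻ ((x , y) ∷ zs) (suc (suc t)))
      ≈⟨ +-congˡ (*-congˡ (*-congˡ (h⁻-suc-suc-∷ t (x , y) zs))) ⟩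
    s * A + x * ((- 1# * s) * (y * A + y * B))
      ≈⟨ alternating-cancel s A B xy≈1 ⟩
    (- 1# * s) * B ∎)
    where
    s A B : Carrier
    s = pow R (- 1#) (suc (length zs))
    A = h⁻ zs (suc t)
    B = h⁻ ((x , y) ∷ zs) (suc t)

  -- At least two variables are needed: h_{-1}(x) = x⁻¹, whereas h_{-1} of two or more variables is 0.
  h-∷-∷ : ∀ k {x y} w ws → x * y ≈ 1# →
    h R k ((x , y) ∷ w ∷ ws) ≈ h R k (w ∷ ws) + x * h R (k ℤ.- + 1) ((x , y) ∷ w ∷ ws)
  h-∷-∷ (+ zero) {x} {y} w ws _ = begin
    h R (+ 0) ((x , y) ∷ w ∷ ws)                              ≈⟨ h-zero ((x , y) ∷ w ∷ ws) ⟩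
    1#                                                         ≈⟨ sym (+-identityʳ 1#) ⟩
    1# + 0#                                                    ≈⟨ +-cong (sym (h-zero (w ∷ ws))) (sym x*h₋₁≈0) ⟩
    h R (+ 0) (w ∷ ws) + x * h R -[1+ 0 ] ((x , y) ∷ w ∷ ws)  ∎
    where
    x*h₋₁≈0 : x * h R -[1+ 0 ] ((x , y) ∷ w ∷ ws) ≈ 0#
    x*h₋₁≈0 = trans (*-congˡ (trans (*-congˡ (h⁻-one-∷-∷ (x , y) w ws)) (zeroʳ _))) (zeroʳ x)
  h-∷-∷ (+ suc k) w ws _     = h-suc-∷ k _ (w ∷ ws)
  h-∷-∷ -[1+ t ]  w ws xy≈1 = trans (h-negsuc-∷ t (w ∷ ws) xy≈1)
    (+-congˡ (*-congˡ (reflexive (≡.cong (λ n → h R -[1+ suc n ] ((_ , _) ∷ w ∷ ws)) (≡.sym (ℕₚ.+-identityʳ t))))))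

  -- The splitting identity

  segment-∷ : ∀ (X Y : ℕ → Carrier) {i j} → i ≤ j →
              segment R X Y i j ≡ (X i , Y i) ∷ segment R X Y (suc i) j
  segment-∷ X Y {i} {j} i≤j rewrite ℕₚ.+-∸-assoc 1 i≤j =
    ≡.cong₂ _∷_ (≡.cong var (ℕₚ.+-identityʳ i))
      (≡.trans (≡.cong (map (var ∘ (i ℕ.+_))) (≡.sym (map-applyUpTo id suc (j ∸ i))))
      (≡.trans (≡.sym (map-∘ (upTo (j ∸ i))))
               (map-cong (λ r → ≡.cong var (ℕₚ.+-suc i r)) (upTo (j ∸ i)))))
    where
    var : ℕ → Var
    var r = X r , Y r

  segment-∷ʳ : ∀ (X Y : ℕ → Carrier) j →
               segment R X Y 1 (suc j) ≡ segment R X Y 1 j ∷ʳ (X (suc j) , Y (suc j))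
  segment-∷ʳ X Y j = ≡.trans (≡.cong (map (λ r → X (suc r) , Y (suc r))) (≡.sym (upTo-∷ʳ j)))
                             (map-++ (λ r → X (suc r) , Y (suc r)) (upTo j) [ j ])

  module _ (X Y : ℕ → Carrier) (n : ℕ) (XY≈1 : ∀ i → 1 ≤ i → i ≤ n → X i * Y i ≈ 1#) (a : ℤ) where

    h≥ : ℕ → ℤ → Carrier
    h≥ i k = h R k (segment R X Y i n)

    h≤ : ℕ → ℕ → Carrier
    h≤ i p = h R (+ p) (segment R X Y 1 i)

    h≥-step : ∀ {i} k → 1 ≤ i → suc i ≤ n → h≥ i k ≈ h≥ (suc i) k + X i * h≥ i (k ℤ.- + 1)
    h≥-step {i} k 1≤i i<n rewrite segment-∷ X Y (ℕₚ.<⇒≤ i<n) | segment-∷ X Y i<n =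
      h-∷-∷ k _ _ (XY≈1 i 1≤i (ℕₚ.<⇒≤ i<n))

    h≤-step : ∀ i p → h≤ (suc i) (suc p) ≈ h≤ i (suc p) + X (suc i) * h≤ (suc i) p
    h≤-step i p = begin
      h R (+ suc p) (segment R X Y 1 (suc i))
        ≡⟨ ≡.cong (h R (+ suc p)) (segment-∷ʳ X Y i) ⟩
      h R (+ suc p) (segment R X Y 1 i ∷ʳ w)
        ≈⟨ h-suc-∷ʳ p (segment R X Y 1 i) w ⟩
      h≤ i (suc p) + X (suc i) * h R (+ p) (segment R X Y 1 i ∷ʳ w)
        ≡⟨ ≡.cong (λ zs → h≤ i (suc p) + X (suc i) * h R (+ p) zs) (≡.sym (segment-∷ʳ X Y i)) ⟩
      h≤ i (suc p) + X (suc i) * h≤ (suc i) p ∎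
      where
      w : Var
      w = X (suc i) , Y (suc i)

    summand : ℕ → ℕ → Carrier
    summand b l = h≥ (b ∸ l) (a ℤ.- + l) * h≤ (b ∸ l) l

    splitting-step : ∀ {b} → 1 ≤ b → suc b ≤ n → ∑< b (summand b) ≈ ∑< (suc b) (summand (suc b))
    splitting-step {b} 1≤b b<n =
      ∑-regroup b {summand b} {summand (suc b)} {c} {u} summand≈c+u summand₀≈c₀ summand≈u+c c-last
      where
      -- c l is the product split disjointly after X (b ∸ l); both sums are Σ c + Σ u.
      c u : ℕ → Carrier
      c l = h≥ (suc (b ∸ l)) (a ℤ.- + l) * h≤ (b ∸ l) l
      u l = (X (b ∸ l) * h≥ (b ∸ l) (a ℤ.- + suc l)) * h≤ (b ∸ l) l

      summand≈c+u : ∀ l → l < b → summand b l ≈ c l + u l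
      summand≈c+u l l<b = begin
        h≥ (b ∸ l) (a ℤ.- + l) * h≤ (b ∸ l) l
          ≈⟨ *-congʳ (h≥-step (a ℤ.- + l) (ℕₚ.m<n⇒0<n∸m l<b) (ℕₚ.≤-trans (s≤s (ℕₚ.m∸n≤m b l)) b<n)) ⟩
        (h≥ (suc (b ∸ l)) (a ℤ.- + l) + X (b ∸ l) * h≥ (b ∸ l) ((a ℤ.- + l) ℤ.- + 1)) * h≤ (b ∸ l) l
          ≈⟨ distribʳ _ _ _ ⟩
        c l + (X (b ∸ l) * h≥ (b ∸ l) ((a ℤ.- + l) ℤ.- + 1)) * h≤ (b ∸ l) l
          ≡⟨ ≡.cong (λ k → c l + (X (b ∸ l) * h≥ (b ∸ l) k) * h≤ (b ∸ l) l) ([i-m]-1≡i-[1+m] a l) ⟩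
        c l + u l ∎

      summand₀≈c₀ : summand (suc b) 0 ≈ c 0
      summand₀≈c₀ = *-congˡ (trans (h-zero (segment R X Y 1 (suc b))) (sym (h-zero (segment R X Y 1 b))))

      summand≈u+c : ∀ l → l < b → summand (suc b) (suc l) ≈ u l + c (suc l)
      summand≈u+c l l<b rewrite n<m⇒m∸n≡1+[m∸[1+n]] l<b = trans (*-congˡ (h≤-step i l))
        (solve 4 (λ A P x Q → A :* (P :+ x :* Q) := (x :* A) :* Q :+ A :* P) refl
               (h≥ (suc i) (a ℤ.- + suc l)) (h≤ i (suc l)) (X (suc i)) (h≤ (suc i) l))
        where
        i : ℕ
        i = b ∸ suc l

      c-last : c b ≈ 0#
      c-last rewrite ℕₚ.n∸n≡0 b = trans (*-congˡ (h-[] 1≤b)) (zeroʳ _)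

    splitting : ∀ b → 1 ≤ b → b ≤ n → h R a (segment R X Y 1 n) ≈ ∑< b (summand b)
    splitting (suc zero)    _ _   = sym (begin
      h≥ 1 (a ℤ.- + 0) * h≤ 1 0 + 0#  ≈⟨ +-identityʳ _ ⟩
      h≥ 1 (a ℤ.- + 0) * h≤ 1 0       ≈⟨ *-cong (reflexive (≡.cong (λ k → h≥ 1 k) (ℤₚ.+-identityʳ a))) (h-zero (segment R X Y 1 1)) ⟩
      h≥ 1 a * 1#                     ≈⟨ *-identityʳ _ ⟩
      h≥ 1 a                          ∎)
    splitting (suc (suc b)) _ 2+b≤n =
      trans (splitting (suc b) (s≤s z≤n) (ℕₚ.<⇒≤ 2+b≤n)) (splitting-step (s≤s z≤n) 2+b≤n)

lemma7p3 : {c ℓ : Level} (R : CommutativeRing c ℓ) →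
    let open CommutativeRing R in
    (X Y : ℕ → Carrier) → (n : ℕ) →
    (∀ i → 1 ≤ i → i ≤ n → X i * Y i ≈ 1#) →
    (a : ℤ) (b : ℕ) → 1 ≤ b → b ≤ n →
    h R a (segment R X Y 1 n)
      ≈ sumR R (map (λ l → h R (a ℤ.- + l) (segment R X Y (b ∸ l) n)
                           * h R (+ l) (segment R X Y 1 (b ∸ l)))
                    (upTo b))
lemma7p3 R X Y n XY≈1 a b 1≤b b≤n =
  trans (splitting R X Y n XY≈1 a b 1≤b b≤n) (reflexive (≡.sym (sumR-map-applyUpTo R (summand R X Y n XY≈1 a b) id b)))
  where open CommutativeRing R using (trans; reflexive)
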